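{- \[ \sum_{\lambda \in \mathcal{P}_{2,a}} t^{\mathrm{odd}(\lambda)} q^{|\lambda|} = \sum_{n=0}^\infty\frac{q^{n(n+1)}\,(-t q;q^2)_n}{(q^2;q^2)_{n}\,(t q;q^2)_{n+1}}, \] where $\mathrm{odd}(\lambda)$ is the number of odd parts of $\lambda$ (with multiplicity) and $|\lambda|$ its weight.
   Context: Colours are $a,b,c$ (indexed $c_0=a$, $c_1=b$, $c_2=c$). A grounded partition in $\mathcal{P}_{2,a}$ is a finite (possibly empty) sequence $(\lambda_1,\dots,\lambda_\ell)$ of positive integers, each carrying a colour in $\{a,b,c\}$, such that, setting $\lambda_0=0$ with colour $a$, for every $0\le j<\ell$, if $\lambda_j$ has colour $c_p$ and $\lambda_{j+1}$ has colour $c_r$, then $\lambda_{j+1}-\lambda_j=|2-p-r|$. Its weight $|\lambda|$ is $\lambda_1+\cdots+\lambda_\ell$. $(x;q)_k=\prod_{j=0}^{k-1}(1-xq^j)$, $(x;q)_0=1$, and similarly for base $q^2$. -}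

module Defs where

open import Data.Nat using (ℕ; zero; suc; _+_; _*_; _∸_; _≤_; _%_; ∣_-_∣; _≡ᵇ_)
open import Data.Bool using (if_then_else_; _∧_)
open import Data.Fin using (Fin; toℕ)
import Data.Fin as F
open import Data.Integer as ℤ using (ℤ; +_)
open import Data.Product using (_×_; _,_; Σ)
open import Data.List using (List; []; _∷_)
open import Data.List.Relation.Unary.All using (All)
open import Data.Unit using (⊤)
open import Relation.Binary.PropositionalEquality using (_≡_)

-- Colours a, b, c are c₀, c₁, c₂, i.e. Fin 3 (a = zero).
Colour : Set
Colour = Fin 3

dist : Colour → Colour → ℕ
dist p r = ∣ 2 - (toℕ p + toℕ r) ∣

-- A coloured sequence: list of (part, colour), λ₁ first.
ColSeq : Set
ColSeq = List (ℕ × Colour)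

GroundedFrom : ℕ → Colour → ColSeq → Set
GroundedFrom v c [] = ⊤
GroundedFrom v c ((x , d) ∷ l) = (x ≡ v + dist c d) × GroundedFrom x d l

Positive : ℕ × Colour → Set
Positive (x , _) = 1 ≤ x

-- membership in P_{2,a}: positive parts, λ₀ = 0 with colour a
Grounded : ColSeq → Set
Grounded l = All Positive l × GroundedFrom 0 F.zero l

weight : ColSeq → ℕ
weight [] = 0
weight ((x , _) ∷ l) = x + weight l

oddCount : ColSeq → ℕ
oddCount [] = 0
oddCount ((x , _) ∷ l) = x % 2 + oddCount l

GP : ℕ → ℕ → Set
GP N k = Σ ColSeq λ l → Grounded l × weight l ≡ N × oddCount l ≡ k

-- Formal power series in t and q with integer coefficients:
-- s i j is the coefficient of t^i q^j.

Series : Set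
Series = ℕ → ℕ → ℤ

sumTo : ℕ → (ℕ → ℤ) → ℤ
sumTo zero f = + 0
sumTo (suc n) f = sumTo n f ℤ.+ f n

_⊕_ : Series → Series → Series
(f ⊕ g) i j = f i j ℤ.+ g i j

_⊖_ : Series → Series → Series
(f ⊖ g) i j = f i j ℤ.- g i j

_⊗_ : Series → Series → Series
(f ⊗ g) i j = sumTo (suc i) λ a → sumTo (suc j) λ b → f a b ℤ.* g (i ∸ a) (j ∸ b)

mono : ℤ → ℕ → ℕ → Series
mono c a b i j = if (i ≡ᵇ a) ∧ (j ≡ᵇ b) then c else + 0

one : Series
one = mono (+ 1) 0 0

pow : Series → ℕ → Series
pow x zero = one
pow x (suc m) = x ⊗ pow x m

prodTo : ℕ → (ℕ → Series) → Series
prodTo zero f = one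
prodTo (suc n) f = prodTo n f ⊗ f n

-- 1/(1 - x) = Σ_{m ≥ 0} x^m, for x without q^0 terms (so x^m only
-- contributes to q-degrees ≥ m, and the sum up to m = j is exact at q^j).
inv1m : Series → Series
inv1m x i j = sumTo (suc j) λ m → pow x m i j

poch2 : Series → ℕ → Series
poch2 x n = prodTo n λ j → one ⊖ (x ⊗ mono (+ 1) 0 (2 * j))

-- 1/(x; q²)_n = Π_{j<n} 1/(1 - x q^{2j})   (x without q^0 terms)
invPoch2 : Series → ℕ → Series
invPoch2 x n = prodTo n λ j → inv1m (x ⊗ mono (+ 1) 0 (2 * j))

-- n-th summand: q^{n(n+1)} (-tq;q²)_n / ((q²;q²)_n (tq;q²)_{n+1})
rhsTerm : ℕ → Series
rhsTerm n = mono (+ 1) 0 (n * (n + 1))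
          ⊗ (poch2 (mono (ℤ.- (+ 1)) 1 1) n
          ⊗ (invPoch2 (mono (+ 1) 0 2) n
          ⊗ invPoch2 (mono (+ 1) 1 1) (suc n)))

-- Σ_{n ≥ 0} rhsTerm n; the n-th term has q-order ≥ n(n+1) ≥ n,
-- so summing n ≤ j gives the exact coefficient of q^j.
rhs : Series
rhs i j = sumTo (suc j) λ n → rhsTerm n i j

-- Every factor of the n-th summand is the generating function of a simple class of
-- objects graded by (t-degree, q-degree): a point, a disjoint union, a product, or a
-- sequence.  Regrouping the factors by j < n, and taking q^{n(n+1)} = q^{2+4+⋯+2n} apart,
-- the summand enumerates level codes: for each j < n an odd run of r parts 2j+1, a flag
-- (the factor 1 + t q^{2j+1}), and m+1 parts 2j+2; then a final odd run of parts 2n+1.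
--
-- On the other side, the difference conditions say that even parts carry colour a or c and
-- odd parts colour b, and that a grounded partition is a walk: after an even part in colour
-- a/c comes the same part in the other colour, the part one larger in colour b, or the part
-- two larger in the same colour; after an odd part comes the same part again, or the part
-- one larger in colour a or c.  A level code is such a walk: level j has r + flag odd parts,
-- and when it has any, the flag also says which colour the next even part takes, which is
-- (1 + x)/(1 − x) = 1 + 2x/(1 − x) for x = t q^{2j+1}.
module Submission where

open import Defs
open import Data.Bool.Base using (Bool; true; false; not; if_then_else_; _∧_)
open import Data.Empty using (⊥; ⊥-elim)
open import Data.Fin.Base as Fin using (Fin)
open import Data.Fin.Properties using (+↔⊎; *↔×)
open import Data.Integer.Base as ℤ using (ℤ; +_)
import Data.Integer.Properties as ℤ
open import Data.List.Base using ([]; _∷_)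
open import Data.List.Relation.Unary.All as All using (All; []; _∷_)
open import Data.Nat.Base using (ℕ; zero; suc; _+_; _*_; _∸_; _≤_; _<_; z≤n; s≤s; _%_; _≡ᵇ_)
open import Data.Nat.DivMod using (m*n%n≡0; [m+kn]%n≡m%n)
import Data.Nat.Properties as ℕ
open import Algebra.Properties.CommutativeSemigroup ℕ.+-commutativeSemigroup using (interchange)
open import Data.Nat.Tactic.RingSolver using (solve-∀)
open import Data.Product.Base using (Σ; _×_; _,_; proj₁)
open import Data.Product.Function.NonDependent.Propositional using (_×-↔_)
open import Data.Sum.Base using (_⊎_; inj₁; inj₂; [_,_])
open import Data.Sum.Function.Propositional using (_⊎-↔_)
open import Data.Unit.Base using (⊤; tt)
open import Function.Bundles using (_↔_; mk↔ₛ′)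
open import Function.Properties.Inverse using (↔-sym; ↔-trans)
open import Relation.Nullary using (Dec; yes; no; does; ¬_)
open import Relation.Binary.PropositionalEquality hiding ([_])

-- Classes graded by t- and q-degree, and their generating functions

record Class : Set₁ where
  field
    Obj  : Set
    tdeg : Obj → ℕ
    qdeg : Obj → ℕ
open Class

Fibre : Class → ℕ → ℕ → Set
Fibre C i j = Σ (Obj C) λ x → tdeg C x ≡ i × qdeg C x ≡ j

infix 4 _IsCardOf_ _IsGFOf_ _≅_

_IsCardOf_ : ℤ → Set → Set
z IsCardOf A = Σ ℕ λ m → z ≡ + m × (Fin m ↔ A)

_IsGFOf_ : Series → Class → Set
s IsGFOf C = ∀ i j → s i j IsCardOf Fibre C i j

fibre-≡ : ∀ C {i j} {x y : Obj C} {p q r s} → x ≡ y →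
          _≡_ {A = Fibre C i j} (x , p , q) (y , r , s)
fibre-≡ C {x = x} refl = cong₂ (λ p q → x , p , q) (ℕ.≡-irrelevant _ _) (ℕ.≡-irrelevant _ _)

IsCardOf-↔ : ∀ {z A B} → z IsCardOf A → A ↔ B → z IsCardOf B
IsCardOf-↔ (m , z≡m , Fin↔A) A↔B = m , z≡m , ↔-trans Fin↔A A↔B

IsCardOf-empty : ∀ {A} → ¬ A → + 0 IsCardOf A
IsCardOf-empty ¬a = 0 , refl , mk↔ₛ′ (λ ()) (λ a → ⊥-elim (¬a a)) (λ a → ⊥-elim (¬a a)) (λ ())

IsCardOf-⊎ : ∀ {z w A B} → z IsCardOf A → w IsCardOf B → z ℤ.+ w IsCardOf (A ⊎ B)
IsCardOf-⊎ (m , refl , f) (n , refl , g) = m + n , refl , ↔-trans +↔⊎ (f ⊎-↔ g)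

IsCardOf-× : ∀ {z w A B} → z IsCardOf A → w IsCardOf B → z ℤ.* w IsCardOf (A × B)
IsCardOf-× (m , refl , f) (n , refl , g) = m * n , sym (ℤ.pos-* m n) , ↔-trans *↔× (f ×-↔ g)

Below : ℕ → (ℕ → Set) → Set
Below n X = Σ ℕ λ a → a < n × X a

module _ {n : ℕ} {X : ℕ → Set} where

  Below-suc↔ : Below (suc n) X ↔ (Below n X ⊎ X n)
  Below-suc↔ = mk↔ₛ′ split join split∘join join∘split
    where
    split : Below (suc n) X → Below n X ⊎ X n
    split (a , a<1+n , x) with ℕ.m<1+n⇒m<n∨m≡n a<1+n
    ... | inj₁ a<n  = inj₁ (a , a<n , x)
    ... | inj₂ refl = inj₂ x

    join : Below n X ⊎ X n → Below (suc n) X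
    join (inj₁ (a , a<n , x)) = a , ℕ.m<n⇒m<1+n a<n , x
    join (inj₂ x)             = n , ℕ.n<1+n n , x

    split∘join : ∀ y → split (join y) ≡ y
    split∘join (inj₁ (a , a<n , x)) with ℕ.m<1+n⇒m<n∨m≡n (ℕ.m<n⇒m<1+n a<n)
    ... | inj₁ a<n′ = cong (λ p → inj₁ (a , p , x)) (ℕ.<-irrelevant a<n′ a<n)
    ... | inj₂ refl = ⊥-elim (ℕ.<-irrefl refl a<n)
    split∘join (inj₂ x) with ℕ.m<1+n⇒m<n∨m≡n (ℕ.n<1+n n)
    ... | inj₁ n<n  = ⊥-elim (ℕ.<-irrefl refl n<n)
    ... | inj₂ refl = refl

    join∘split : ∀ z → join (split z) ≡ z
    join∘split (a , a<1+n , x) with ℕ.m<1+n⇒m<n∨m≡n a<1+n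
    ... | inj₁ _    = cong (λ p → a , p , x) (ℕ.<-irrelevant _ _)
    ... | inj₂ refl = cong (λ p → n , p , x) (ℕ.<-irrelevant _ _)

  Below↔Σ : (∀ a → X a → a < n) → Below n X ↔ Σ ℕ X
  Below↔Σ bound = mk↔ₛ′ (λ (a , _ , x) → a , x) (λ (a , x) → a , bound a x , x)
    (λ _ → refl) (λ (a , _ , x) → cong (λ p → a , p , x) (ℕ.<-irrelevant _ _))

IsCardOf-sumTo : ∀ n {f : ℕ → ℤ} {X : ℕ → Set} →
                 (∀ a → f a IsCardOf X a) → sumTo n f IsCardOf Below n X
IsCardOf-sumTo zero    _ = IsCardOf-empty λ { (_ , () , _) }
IsCardOf-sumTo (suc n) c = IsCardOf-↔ (IsCardOf-⊎ (IsCardOf-sumTo n c) (c n)) (↔-sym Below-suc↔)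

record _≅_ (C D : Class) : Set where
  field
    to      : Obj C → Obj D
    from    : Obj D → Obj C
    from∘to : ∀ x → from (to x) ≡ x
    to∘from : ∀ y → to (from y) ≡ y
    tdeg-to : ∀ x → tdeg D (to x) ≡ tdeg C x
    qdeg-to : ∀ x → qdeg D (to x) ≡ qdeg C x
open _≅_

≅-refl : ∀ C → C ≅ C
≅-refl C = record
  { to = λ x → x ; from = λ x → x ; from∘to = λ _ → refl ; to∘from = λ _ → refl
  ; tdeg-to = λ _ → refl ; qdeg-to = λ _ → refl }

≡⇒≅ : ∀ {C D} → C ≡ D → C ≅ D
≡⇒≅ {C} refl = ≅-refl C

≅-sym : ∀ {C D} → C ≅ D → D ≅ C
≅-sym {C} {D} e = record
  { to = from e ; from = to e ; from∘to = to∘from e ; to∘from = from∘to e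
  ; tdeg-to = λ y → trans (sym (tdeg-to e (from e y))) (cong (tdeg D) (to∘from e y))
  ; qdeg-to = λ y → trans (sym (qdeg-to e (from e y))) (cong (qdeg D) (to∘from e y)) }

≅-trans : ∀ {C D E} → C ≅ D → D ≅ E → C ≅ E
≅-trans e f = record
  { to = λ x → to f (to e x) ; from = λ z → from e (from f z)
  ; from∘to = λ x → trans (cong (from e) (from∘to f (to e x))) (from∘to e x)
  ; to∘from = λ z → trans (cong (to f) (to∘from e (from f z))) (to∘from f z)
  ; tdeg-to = λ x → trans (tdeg-to f (to e x)) (tdeg-to e x)
  ; qdeg-to = λ x → trans (qdeg-to f (to e x)) (qdeg-to e x) }

module ≅-Reasoning where
  infix  1 begin_
  infixr 2 _≅⟨_⟩_
  infix  3 _∎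

  begin_ : ∀ {C D} → C ≅ D → C ≅ D
  begin e = e

  _≅⟨_⟩_ : ∀ C {D E} → C ≅ D → D ≅ E → C ≅ E
  C ≅⟨ e ⟩ f = ≅-trans e f

  _∎ : ∀ C → C ≅ C
  C ∎ = ≅-refl C

≅⇒Fibre↔ : ∀ {C D} → C ≅ D → ∀ {i j} → Fibre C i j ↔ Fibre D i j
≅⇒Fibre↔ {C} {D} e = mk↔ₛ′ (transport e) (transport (≅-sym e))
  (λ (y , _) → fibre-≡ D (to∘from e y)) (λ (x , _) → fibre-≡ C (from∘to e x))
  where
  transport : ∀ {C D} → C ≅ D → ∀ {i j} → Fibre C i j → Fibre D i j
  transport e (x , p , q) = to e x , trans (tdeg-to e x) p , trans (qdeg-to e x) q

IsGFOf-≅ : ∀ {s C D} → s IsGFOf C → C ≅ D → s IsGFOf D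
IsGFOf-≅ c e i j = IsCardOf-↔ (c i j) (≅⇒Fibre↔ e)

IsGFOf-≗ : ∀ {s s′ C} → s IsGFOf C → (∀ i j → s i j ≡ s′ i j) → s′ IsGFOf C
IsGFOf-≗ c s≗s′ i j rewrite sym (s≗s′ i j) = c i j

Point : ℕ → ℕ → Class
Point a b = record { Obj = ⊤ ; tdeg = λ _ → a ; qdeg = λ _ → b }

ℕᶜ : (ℕ → ℕ) → (ℕ → ℕ) → Class
ℕᶜ f g = record { Obj = ℕ ; tdeg = f ; qdeg = g }

infixr 6 _⊎ᶜ_
infixr 7 _×ᶜ_

_⊎ᶜ_ : Class → Class → Class
C ⊎ᶜ D = record { Obj = Obj C ⊎ Obj D ; tdeg = [ tdeg C , tdeg D ] ; qdeg = [ qdeg C , qdeg D ] }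

_×ᶜ_ : Class → Class → Class
C ×ᶜ D = record
  { Obj = Obj C × Obj D
  ; tdeg = λ (x , y) → tdeg C x + tdeg D y
  ; qdeg = λ (x , y) → qdeg C x + qdeg D y }

Σᶜ : (ℕ → Class) → Class
Σᶜ F = record
  { Obj = Σ ℕ λ n → Obj (F n)
  ; tdeg = λ (n , x) → tdeg (F n) x
  ; qdeg = λ (n , x) → qdeg (F n) x }

Powᶜ : Class → ℕ → Class
Powᶜ C zero    = Point 0 0
Powᶜ C (suc m) = C ×ᶜ Powᶜ C m

Seqᶜ : Class → Class
Seqᶜ C = Σᶜ (Powᶜ C)

Prodᶜ : ℕ → (ℕ → Class) → Class
Prodᶜ zero    F = Point 0 0
Prodᶜ (suc n) F = Prodᶜ n F ×ᶜ F n

mono-IsGF : ∀ a b → mono (+ 1) a b IsGFOf Point a b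
mono-IsGF a b i j = count (i ℕ.≟ a) (j ℕ.≟ b)
  -- mono tests with _≡ᵇ_, and does (m ℕ.≟ n) reduces to m ≡ᵇ n.
  where
  count : (i≟a : Dec (i ≡ a)) (j≟b : Dec (j ≡ b)) →
          (if does i≟a ∧ does j≟b then + 1 else + 0) IsCardOf Fibre (Point a b) i j
  count (yes refl) (yes refl) = 1 , refl , mk↔ₛ′ (λ _ → tt , refl , refl) (λ _ → Fin.zero)
    (λ { (tt , refl , refl) → refl }) (λ { Fin.zero → refl ; (Fin.suc ()) })
  count (no i≢a) _        = IsCardOf-empty λ (_ , a≡i , _) → i≢a (sym a≡i)
  count (yes _) (no j≢b)  = IsCardOf-empty λ (_ , _ , b≡j) → j≢b (sym b≡j)

⊕-IsGF : ∀ {f g C D} → f IsGFOf C → g IsGFOf D → f ⊕ g IsGFOf C ⊎ᶜ D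
⊕-IsGF {C = C} {D} cf cg i j = IsCardOf-↔ (IsCardOf-⊎ (cf i j) (cg i j)) fibres↔
  where
  fibres↔ : (Fibre C i j ⊎ Fibre D i j) ↔ Fibre (C ⊎ᶜ D) i j
  fibres↔ = mk↔ₛ′
    (λ { (inj₁ (x , p , q)) → inj₁ x , p , q ; (inj₂ (y , p , q)) → inj₂ y , p , q })
    (λ { (inj₁ x , p , q) → inj₁ (x , p , q) ; (inj₂ y , p , q) → inj₂ (y , p , q) })
    (λ { (inj₁ _ , _) → refl ; (inj₂ _ , _) → refl })
    (λ { (inj₁ _) → refl ; (inj₂ _) → refl })

module _ (C D : Class) (i j : ℕ) where

  Splittings : Set
  Splittings = Below (suc i) λ a → Below (suc j) λ b → Fibre C a b × Fibre D (i ∸ a) (j ∸ b)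

  Splittings↔Fibre-× : Splittings ↔ Fibre (C ×ᶜ D) i j
  Splittings↔Fibre-× = mk↔ₛ′ join split join∘split split∘join
    where
    <-of-+ : ∀ {x y n} → x + y ≡ n → x < suc n
    <-of-+ {x} {y} refl = s≤s (ℕ.m≤m+n x y)

    ∸-of-+ : ∀ {x y n} → x + y ≡ n → y ≡ n ∸ x
    ∸-of-+ {x} {y} refl = sym (ℕ.m+n∸m≡n x y)

    +-of-∸ : ∀ {x y n} → x < suc n → y ≡ n ∸ x → x + y ≡ n
    +-of-∸ x<1+n refl = ℕ.m+[n∸m]≡n (ℕ.≤-pred x<1+n)

    join : Splittings → Fibre (C ×ᶜ D) i j
    join (_ , a< , _ , b< , (x , refl , refl) , (y , p , q)) = (x , y) , +-of-∸ a< p , +-of-∸ b< q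

    split : Fibre (C ×ᶜ D) i j → Splittings
    split ((x , y) , p , q) =
      tdeg C x , <-of-+ p , qdeg C x , <-of-+ q , (x , refl , refl) , (y , ∸-of-+ p , ∸-of-+ q)

    join∘split : ∀ z → join (split z) ≡ z
    join∘split _ = fibre-≡ (C ×ᶜ D) refl

    split∘join : ∀ z → split (join z) ≡ z
    split∘join (_ , a< , _ , b< , (x , refl , refl) , (y , p , q))
      rewrite ℕ.<-irrelevant (<-of-+ (+-of-∸ a< p)) a< | ℕ.<-irrelevant (<-of-+ (+-of-∸ b< q)) b<
      = cong₂ (λ p′ q′ → _ , a< , _ , b< , (x , refl , refl) , (y , p′ , q′))
              (ℕ.≡-irrelevant _ _) (ℕ.≡-irrelevant _ _)

⊗-IsGF : ∀ {f g C D} → f IsGFOf C → g IsGFOf D → f ⊗ g IsGFOf C ×ᶜ D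
⊗-IsGF {C = C} {D} cf cg i j = IsCardOf-↔
  (IsCardOf-sumTo (suc i) λ a → IsCardOf-sumTo (suc j) λ b →
     IsCardOf-× (cf a b) (cg (i ∸ a) (j ∸ b)))
  (Splittings↔Fibre-× C D i j)

-- The bound on q-degrees makes the truncated sum defining the coefficient exact.
Σᶜ-IsGF : ∀ {h : ℕ → Series} {F : ℕ → Class} → (∀ n → h n IsGFOf F n) →
          (∀ n x → n ≤ qdeg (F n) x) → (λ i j → sumTo (suc j) λ n → h n i j) IsGFOf Σᶜ F
Σᶜ-IsGF {F = F} c bound i j = IsCardOf-↔ (IsCardOf-sumTo (suc j) λ n → c n i j)
  (↔-trans (Below↔Σ λ { n (x , _ , refl) → s≤s (bound n x) }) Σ-Fibre↔)
  where
  Σ-Fibre↔ : Σ ℕ (λ n → Fibre (F n) i j) ↔ Fibre (Σᶜ F) i j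
  Σ-Fibre↔ = mk↔ₛ′ (λ (n , x , p , q) → (n , x) , p , q) (λ ((n , x) , p , q) → n , x , p , q)
    (λ _ → refl) (λ _ → refl)

pow-IsGF : ∀ {x C} → x IsGFOf C → ∀ m → pow x m IsGFOf Powᶜ C m
pow-IsGF c zero    = mono-IsGF 0 0
pow-IsGF c (suc m) = ⊗-IsGF c (pow-IsGF c m)

inv1m-IsGF : ∀ {x C} → x IsGFOf C → (∀ y → 1 ≤ qdeg C y) → inv1m x IsGFOf Seqᶜ C
inv1m-IsGF {C = C} c positive = Σᶜ-IsGF (pow-IsGF c) m≤qdeg
  where
  m≤qdeg : ∀ m y → m ≤ qdeg (Powᶜ C m) y
  m≤qdeg zero    _       = z≤n
  m≤qdeg (suc m) (y , z) = ℕ.+-mono-≤ (positive y) (m≤qdeg m z)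

prodTo-IsGF : ∀ {f F} → (∀ j → f j IsGFOf F j) → ∀ n → prodTo n f IsGFOf Prodᶜ n F
prodTo-IsGF c zero    = mono-IsGF 0 0
prodTo-IsGF c (suc n) = ⊗-IsGF (prodTo-IsGF c n) (c n)

sumTo-cong : ∀ n {f g : ℕ → ℤ} → (∀ a → f a ≡ g a) → sumTo n f ≡ sumTo n g
sumTo-cong zero    _   = refl
sumTo-cong (suc n) f≗g = cong₂ ℤ._+_ (sumTo-cong n f≗g) (f≗g n)

sumTo-neg : ∀ n (f : ℕ → ℤ) → sumTo n (λ a → ℤ.- f a) ≡ ℤ.- sumTo n f
sumTo-neg zero    f = refl
sumTo-neg (suc n) f =
  trans (cong (ℤ._+ ℤ.- f n) (sumTo-neg n f)) (sym (ℤ.neg-distrib-+ (sumTo n f) (f n)))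

mono-neg : ∀ c a b i j → mono (ℤ.- c) a b i j ≡ ℤ.- mono c a b i j
mono-neg c a b i j with (i ≡ᵇ a) ∧ (j ≡ᵇ b)
... | true  = refl
... | false = refl

⊗-negˡ : ∀ {f f′ : Series} g → (∀ a b → f′ a b ≡ ℤ.- f a b) →
         ∀ i j → (f′ ⊗ g) i j ≡ ℤ.- (f ⊗ g) i j
⊗-negˡ {f} g f′≗-f i j = trans (sumTo-cong (suc i) λ a → trans
    (sumTo-cong (suc j) λ b → trans (cong (ℤ._* g (i ∸ a) (j ∸ b)) (f′≗-f a b))
                                    (sym (ℤ.neg-distribˡ-* (f a b) (g (i ∸ a) (j ∸ b)))))
    (sumTo-neg (suc j) _))
  (sumTo-neg (suc i) _)

onePlus-IsGF : ∀ {x C} → x IsGFOf C →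
               one ⊖ (mono (ℤ.- (+ 1)) 1 1 ⊗ x) IsGFOf Point 0 0 ⊎ᶜ (Point 1 1 ×ᶜ C)
onePlus-IsGF {x} c = IsGFOf-≗ (⊕-IsGF (mono-IsGF 0 0) (⊗-IsGF (mono-IsGF 1 1) c)) λ i j →
  cong (λ z → one i j ℤ.+ z) (begin
    (mono (+ 1) 1 1 ⊗ x) i j                  ≡⟨ sym (ℤ.neg-involutive _) ⟩
    ℤ.- ℤ.- (mono (+ 1) 1 1 ⊗ x) i j          ≡⟨ cong ℤ.-_ (sym (⊗-negˡ x (mono-neg (+ 1) 1 1) i j)) ⟩
    ℤ.- (mono (ℤ.- (+ 1)) 1 1 ⊗ x) i j        ∎)
  where open ≡-Reasoning

FlagFactorᶜ EvenGeomᶜ OddGeomᶜ : ℕ → Class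
FlagFactorᶜ j = Point 0 0 ⊎ᶜ (Point 1 1 ×ᶜ Point 0 (2 * j))
EvenGeomᶜ   j = Seqᶜ (Point 0 2 ×ᶜ Point 0 (2 * j))
OddGeomᶜ    j = Seqᶜ (Point 1 1 ×ᶜ Point 0 (2 * j))

Termᶜ : ℕ → Class
Termᶜ n = Point 0 (n * (n + 1))
       ×ᶜ (Prodᶜ n FlagFactorᶜ ×ᶜ (Prodᶜ n EvenGeomᶜ ×ᶜ Prodᶜ (suc n) OddGeomᶜ))

rhsTerm-IsGF : ∀ n → rhsTerm n IsGFOf Termᶜ n
rhsTerm-IsGF n = ⊗-IsGF (mono-IsGF 0 (n * (n + 1)))
  (⊗-IsGF (prodTo-IsGF flag n) (⊗-IsGF (prodTo-IsGF evenGeom n) (prodTo-IsGF oddGeom (suc n))))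
  where
  flag : ∀ j → one ⊖ (mono (ℤ.- (+ 1)) 1 1 ⊗ mono (+ 1) 0 (2 * j)) IsGFOf FlagFactorᶜ j
  flag j = onePlus-IsGF (mono-IsGF 0 (2 * j))
  evenGeom : ∀ j → inv1m (mono (+ 1) 0 2 ⊗ mono (+ 1) 0 (2 * j)) IsGFOf EvenGeomᶜ j
  evenGeom j = inv1m-IsGF (⊗-IsGF (mono-IsGF 0 2) (mono-IsGF 0 (2 * j))) λ _ → s≤s z≤n
  oddGeom : ∀ j → inv1m (mono (+ 1) 1 1 ⊗ mono (+ 1) 0 (2 * j)) IsGFOf OddGeomᶜ j
  oddGeom j = inv1m-IsGF (⊗-IsGF (mono-IsGF 1 1) (mono-IsGF 0 (2 * j))) λ _ → s≤s z≤n

rhs-IsGF : rhs IsGFOf Σᶜ Termᶜ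
rhs-IsGF = Σᶜ-IsGF rhsTerm-IsGF λ n _ → ℕ.≤-trans (n≤n*[n+1] n) (ℕ.m≤m+n (n * (n + 1)) _)
  where
  n≤n*[n+1] : ∀ n → n ≤ n * (n + 1)
  n≤n*[n+1] n = subst (λ k → n ≤ n * k) (ℕ.+-comm 1 n) (ℕ.m≤m*n n (suc n))

-- Regrouping a summand by levels

×ᶜ-cong : ∀ {A A′ B B′} → A ≅ A′ → B ≅ B′ → A ×ᶜ B ≅ A′ ×ᶜ B′
×ᶜ-cong e f = record
  { to = λ (x , y) → to e x , to f y
  ; from = λ (x , y) → from e x , from f y
  ; from∘to = λ (x , y) → cong₂ _,_ (from∘to e x) (from∘to f y)
  ; to∘from = λ (x , y) → cong₂ _,_ (to∘from e x) (to∘from f y)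
  ; tdeg-to = λ (x , y) → cong₂ _+_ (tdeg-to e x) (tdeg-to f y)
  ; qdeg-to = λ (x , y) → cong₂ _+_ (qdeg-to e x) (qdeg-to f y) }

×ᶜ-identityˡ : ∀ A → Point 0 0 ×ᶜ A ≅ A
×ᶜ-identityˡ A = record
  { to = λ (_ , x) → x ; from = λ x → tt , x ; from∘to = λ _ → refl ; to∘from = λ _ → refl
  ; tdeg-to = λ _ → refl ; qdeg-to = λ _ → refl }

×ᶜ-identityʳ : ∀ A → A ×ᶜ Point 0 0 ≅ A
×ᶜ-identityʳ A = record
  { to = proj₁ ; from = λ x → x , tt ; from∘to = λ _ → refl ; to∘from = λ _ → refl
  ; tdeg-to = λ (x , _) → sym (ℕ.+-identityʳ (tdeg A x))
  ; qdeg-to = λ (x , _) → sym (ℕ.+-identityʳ (qdeg A x)) }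

×ᶜ-assoc : ∀ A B C → (A ×ᶜ B) ×ᶜ C ≅ A ×ᶜ (B ×ᶜ C)
×ᶜ-assoc A B C = record
  { to = λ ((a , b) , c) → a , (b , c) ; from = λ (a , (b , c)) → (a , b) , c
  ; from∘to = λ _ → refl ; to∘from = λ _ → refl
  ; tdeg-to = λ ((a , b) , c) → sym (ℕ.+-assoc (tdeg A a) (tdeg B b) (tdeg C c))
  ; qdeg-to = λ ((a , b) , c) → sym (ℕ.+-assoc (qdeg A a) (qdeg B b) (qdeg C c)) }

×ᶜ-interchange : ∀ A B C D → (A ×ᶜ B) ×ᶜ (C ×ᶜ D) ≅ (A ×ᶜ C) ×ᶜ (B ×ᶜ D)
×ᶜ-interchange A B C D = record
  { to = λ ((a , b) , (c , d)) → (a , c) , (b , d)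
  ; from = λ ((a , c) , (b , d)) → (a , b) , (c , d)
  ; from∘to = λ _ → refl ; to∘from = λ _ → refl
  ; tdeg-to = λ ((a , b) , (c , d)) → interchange (tdeg A a) (tdeg C c) (tdeg B b) (tdeg D d)
  ; qdeg-to = λ ((a , b) , (c , d)) → interchange (qdeg A a) (qdeg C c) (qdeg B b) (qdeg D d) }

×ᶜ-rotate : ∀ A B C D → A ×ᶜ (B ×ᶜ (C ×ᶜ D)) ≅ D ×ᶜ (B ×ᶜ (A ×ᶜ C))
×ᶜ-rotate A B C D = record
  { to = λ (a , b , c , d) → d , b , a , c
  ; from = λ (d , b , a , c) → a , b , c , d
  ; from∘to = λ _ → refl ; to∘from = λ _ → refl
  ; tdeg-to = λ (a , b , c , d) → rotate (tdeg A a) (tdeg B b) (tdeg C c) (tdeg D d)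
  ; qdeg-to = λ (a , b , c , d) → rotate (qdeg A a) (qdeg B b) (qdeg C c) (qdeg D d) }
  where
  rotate : ∀ a b c d → d + (b + (a + c)) ≡ a + (b + (c + d))
  rotate = solve-∀

Point-+ : ∀ a b c d → Point a b ×ᶜ Point c d ≅ Point (a + c) (b + d)
Point-+ a b c d = record
  { to = λ _ → tt ; from = λ _ → tt , tt ; from∘to = λ _ → refl ; to∘from = λ _ → refl
  ; tdeg-to = λ _ → refl ; qdeg-to = λ _ → refl }

Σᶜ-cong : ∀ {F G : ℕ → Class} → (∀ n → F n ≅ G n) → Σᶜ F ≅ Σᶜ G
Σᶜ-cong e = record
  { to = λ (n , x) → n , to (e n) x
  ; from = λ (n , y) → n , from (e n) y
  ; from∘to = λ (n , x) → cong (n ,_) (from∘to (e n) x)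
  ; to∘from = λ (n , y) → cong (n ,_) (to∘from (e n) y)
  ; tdeg-to = λ (n , x) → tdeg-to (e n) x
  ; qdeg-to = λ (n , x) → qdeg-to (e n) x }

ℕᶜ-cong : ∀ {f g f′ g′} → (∀ m → f m ≡ f′ m) → (∀ m → g m ≡ g′ m) → ℕᶜ f g ≅ ℕᶜ f′ g′
ℕᶜ-cong f≗f′ g≗g′ = record
  { to = λ m → m ; from = λ m → m ; from∘to = λ _ → refl ; to∘from = λ _ → refl
  ; tdeg-to = λ m → sym (f≗f′ m) ; qdeg-to = λ m → sym (g≗g′ m) }

Seqᶜ-Point : ∀ {C a b} → C ≅ Point a b → Seqᶜ C ≅ ℕᶜ (λ m → m * a) (λ m → m * b)
Seqᶜ-Point {C} {a} {b} e = ≅-trans (Σᶜ-cong (Powᶜ-Point e)) (record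
  { to = proj₁ ; from = λ m → m , tt ; from∘to = λ _ → refl ; to∘from = λ _ → refl
  ; tdeg-to = λ _ → refl ; qdeg-to = λ _ → refl })
  where
  Powᶜ-Point : C ≅ Point a b → ∀ m → Powᶜ C m ≅ Point (m * a) (m * b)
  Powᶜ-Point e zero    = ≅-refl (Point 0 0)
  Powᶜ-Point e (suc m) = ≅-trans (×ᶜ-cong e (Powᶜ-Point e m)) (Point-+ a b (m * a) (m * b))

ProdFromᶜ : ℕ → ℕ → (ℕ → Class) → Class
ProdFromᶜ s zero    F = Point 0 0
ProdFromᶜ s (suc n) F = F s ×ᶜ ProdFromᶜ (suc s) n F

ProdFromᶜ-snoc : ∀ F s n → ProdFromᶜ s (suc n) F ≅ ProdFromᶜ s n F ×ᶜ F (s + n)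
ProdFromᶜ-snoc F s zero = begin
  F s ×ᶜ Point 0 0          ≅⟨ ×ᶜ-identityʳ (F s) ⟩
  F s                       ≅⟨ ≅-sym (×ᶜ-identityˡ (F s)) ⟩
  Point 0 0 ×ᶜ F s          ≅⟨ ×ᶜ-cong (≅-refl _) (≡⇒≅ (cong F (sym (ℕ.+-identityʳ s)))) ⟩
  Point 0 0 ×ᶜ F (s + 0)    ∎
  where open ≅-Reasoning
ProdFromᶜ-snoc F s (suc n) = begin
  F s ×ᶜ ProdFromᶜ (suc s) (suc n) F
    ≅⟨ ×ᶜ-cong (≅-refl (F s)) (ProdFromᶜ-snoc F (suc s) n) ⟩
  F s ×ᶜ (ProdFromᶜ (suc s) n F ×ᶜ F (suc s + n))
    ≅⟨ ≅-sym (×ᶜ-assoc (F s) _ _) ⟩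
  (F s ×ᶜ ProdFromᶜ (suc s) n F) ×ᶜ F (suc s + n)
    ≅⟨ ×ᶜ-cong (≅-refl _) (≡⇒≅ (cong F (sym (ℕ.+-suc s n)))) ⟩
  ProdFromᶜ s (suc n) F ×ᶜ F (s + suc n)
    ∎
  where open ≅-Reasoning

Prodᶜ≅ProdFromᶜ : ∀ F n → Prodᶜ n F ≅ ProdFromᶜ 0 n F
Prodᶜ≅ProdFromᶜ F zero    = ≅-refl (Point 0 0)
Prodᶜ≅ProdFromᶜ F (suc n) =
  ≅-trans (×ᶜ-cong (Prodᶜ≅ProdFromᶜ F n) (≅-refl (F n))) (≅-sym (ProdFromᶜ-snoc F 0 n))

ProdFromᶜ-zip : ∀ F G s n →
                ProdFromᶜ s n F ×ᶜ ProdFromᶜ s n G ≅ ProdFromᶜ s n (λ j → F j ×ᶜ G j)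
ProdFromᶜ-zip F G s zero    = ×ᶜ-identityʳ (Point 0 0)
ProdFromᶜ-zip F G s (suc n) = ≅-trans (×ᶜ-interchange (F s) _ (G s) _)
                                     (×ᶜ-cong (≅-refl (F s ×ᶜ G s)) (ProdFromᶜ-zip F G (suc s) n))

ProdFromᶜ-staircase : ∀ s n →
                      ProdFromᶜ s n (λ j → Point 0 (2 * suc j)) ≅ Point 0 (2 * s * n + n * (n + 1))
ProdFromᶜ-staircase s zero = ≡⇒≅ (cong (Point 0) (sym (trans (ℕ.+-identityʳ _) (ℕ.*-zeroʳ (2 * s)))))
ProdFromᶜ-staircase s (suc n) = begin
  Point 0 (2 * suc s) ×ᶜ ProdFromᶜ (suc s) n (λ j → Point 0 (2 * suc j))
    ≅⟨ ×ᶜ-cong (≅-refl _) (ProdFromᶜ-staircase (suc s) n) ⟩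
  Point 0 (2 * suc s) ×ᶜ Point 0 (2 * suc s * n + n * (n + 1))
    ≅⟨ Point-+ 0 (2 * suc s) 0 _ ⟩
  Point 0 (2 * suc s + (2 * suc s * n + n * (n + 1)))
    ≅⟨ ≡⇒≅ (cong (Point 0) (staircase s n)) ⟩
  Point 0 (2 * s * suc n + suc n * (suc n + 1))
    ∎
  where
  open ≅-Reasoning
  staircase : ∀ s n →
              2 * suc s + (2 * suc s * n + n * (n + 1)) ≡ 2 * s * suc n + suc n * (suc n + 1)
  staircase = solve-∀

Levelsᶜ : ℕ → ℕ → (ℕ → Class) → (ℕ → Class) → Class
Levelsᶜ s zero    O L = O s
Levelsᶜ s (suc n) O L = (O s ×ᶜ L s) ×ᶜ Levelsᶜ (suc s) n O L

ProdFromᶜ-interleave : ∀ O L s n → ProdFromᶜ s (suc n) O ×ᶜ ProdFromᶜ s n L ≅ Levelsᶜ s n O L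
ProdFromᶜ-interleave O L s zero    = ≅-trans (×ᶜ-identityʳ _) (×ᶜ-identityʳ (O s))
ProdFromᶜ-interleave O L s (suc n) =
  ≅-trans (×ᶜ-interchange (O s) _ (L s) _)
          (×ᶜ-cong (≅-refl (O s ×ᶜ L s)) (ProdFromᶜ-interleave O L (suc s) n))

Levelsᶜ-cong : ∀ {O O′ L L′} → (∀ j → O j ≅ O′ j) → (∀ j → L j ≅ L′ j) →
               ∀ s n → Levelsᶜ s n O L ≅ Levelsᶜ s n O′ L′
Levelsᶜ-cong eO eL s zero    = eO s
Levelsᶜ-cong eO eL s (suc n) = ×ᶜ-cong (×ᶜ-cong (eO s) (eL s)) (Levelsᶜ-cong eO eL (suc s) n)

bit : Bool → ℕ
bit false = 0
bit true  = 1

OddRunᶜ Flagᶜ ClimbRunᶜ LevelStepᶜ : ℕ → Class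
OddRunᶜ   j = ℕᶜ (λ r → r) (λ r → r * suc (2 * j))
Flagᶜ     j = record { Obj = Bool ; tdeg = bit ; qdeg = λ e → bit e * suc (2 * j) }
ClimbRunᶜ j = ℕᶜ (λ _ → 0) (λ m → suc m * (2 * suc j))
LevelStepᶜ j = record
  { Obj = Bool × ℕ
  ; tdeg = λ (e , _) → bit e
  ; qdeg = λ (e , m) → bit e * suc (2 * j) + suc m * (2 * suc j) }

OddGeom≅OddRun : ∀ j → OddGeomᶜ j ≅ OddRunᶜ j
OddGeom≅OddRun j = ≅-trans (Seqᶜ-Point (Point-+ 1 1 0 (2 * j))) (ℕᶜ-cong ℕ.*-identityʳ λ _ → refl)

FlagFactor≅Flag : ∀ j → FlagFactorᶜ j ≅ Flagᶜ j
FlagFactor≅Flag j = record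
  { to = [ (λ _ → false) , (λ _ → true) ]
  ; from = λ { false → inj₁ tt ; true → inj₂ (tt , tt) }
  ; from∘to = λ { (inj₁ tt) → refl ; (inj₂ (tt , tt)) → refl }
  ; to∘from = λ { false → refl ; true → refl }
  ; tdeg-to = λ { (inj₁ _) → refl ; (inj₂ _) → refl }
  ; qdeg-to = λ { (inj₁ _) → refl ; (inj₂ _) → ℕ.+-identityʳ (suc (2 * j)) } }

Climb×EvenGeom≅ClimbRun : ∀ j → Point 0 (2 * suc j) ×ᶜ EvenGeomᶜ j ≅ ClimbRunᶜ j
Climb×EvenGeom≅ClimbRun j =
  ≅-trans (×ᶜ-cong (≅-refl (Point 0 (2 * suc j))) (Seqᶜ-Point (Point-+ 0 2 0 (2 * j)))) (record
  { to = λ (_ , m) → m ; from = λ m → tt , m ; from∘to = λ _ → refl ; to∘from = λ _ → refl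
  ; tdeg-to = λ (_ , m) → sym (ℕ.*-zeroʳ m)
  ; qdeg-to = λ (_ , m) → climb j m })
  where
  climb : ∀ j m → suc m * (2 * suc j) ≡ 2 * suc j + m * (2 + 2 * j)
  climb = solve-∀

Flag×ClimbRun≅LevelStep : ∀ j → Flagᶜ j ×ᶜ ClimbRunᶜ j ≅ LevelStepᶜ j
Flag×ClimbRun≅LevelStep j = record
  { to = λ x → x ; from = λ x → x ; from∘to = λ _ → refl ; to∘from = λ _ → refl
  ; tdeg-to = λ (e , _) → sym (ℕ.+-identityʳ (bit e)) ; qdeg-to = λ _ → refl }

Term≅Levels : ∀ n → Termᶜ n ≅ Levelsᶜ 0 n OddRunᶜ LevelStepᶜ
Term≅Levels n = begin
  Termᶜ n
    ≅⟨ ×ᶜ-cong (≅-sym (ProdFromᶜ-staircase 0 n))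
               (×ᶜ-cong (Prodᶜ≅ProdFromᶜ FlagFactorᶜ n)
                        (×ᶜ-cong (Prodᶜ≅ProdFromᶜ EvenGeomᶜ n) (Prodᶜ≅ProdFromᶜ OddGeomᶜ (suc n)))) ⟩
  From n Climb ×ᶜ (From n FlagFactorᶜ ×ᶜ (From n EvenGeomᶜ ×ᶜ From (suc n) OddGeomᶜ))
    ≅⟨ ×ᶜ-rotate (From n Climb) (From n FlagFactorᶜ) (From n EvenGeomᶜ) (From (suc n) OddGeomᶜ) ⟩
  From (suc n) OddGeomᶜ ×ᶜ (From n FlagFactorᶜ ×ᶜ (From n Climb ×ᶜ From n EvenGeomᶜ))
    ≅⟨ ×ᶜ-cong (≅-refl (From (suc n) OddGeomᶜ))
               (≅-trans (×ᶜ-cong (≅-refl (From n FlagFactorᶜ)) (ProdFromᶜ-zip Climb EvenGeomᶜ 0 n))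
                        (ProdFromᶜ-zip FlagFactorᶜ _ 0 n)) ⟩
  From (suc n) OddGeomᶜ ×ᶜ From n (λ j → FlagFactorᶜ j ×ᶜ (Climb j ×ᶜ EvenGeomᶜ j))
    ≅⟨ ProdFromᶜ-interleave OddGeomᶜ _ 0 n ⟩
  Levelsᶜ 0 n OddGeomᶜ (λ j → FlagFactorᶜ j ×ᶜ (Climb j ×ᶜ EvenGeomᶜ j))
    ≅⟨ Levelsᶜ-cong OddGeom≅OddRun step 0 n ⟩
  Levelsᶜ 0 n OddRunᶜ LevelStepᶜ
    ∎
  where
  open ≅-Reasoning
  From : ℕ → (ℕ → Class) → Class
  From = ProdFromᶜ 0
  Climb : ℕ → Class
  Climb j = Point 0 (2 * suc j)
  step : ∀ j → FlagFactorᶜ j ×ᶜ (Climb j ×ᶜ EvenGeomᶜ j) ≅ LevelStepᶜ j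
  step j = ≅-trans (×ᶜ-cong (FlagFactor≅Flag j) (Climb×EvenGeom≅ClimbRun j)) (Flag×ClimbRun≅LevelStep j)

data LevelCode : Set where
  top   : ℕ → LevelCode
  climb : ℕ → Bool → ℕ → LevelCode → LevelCode

tdegL : LevelCode → ℕ
tdegL (top r)         = r
tdegL (climb r e _ a) = r + bit e + tdegL a

qdegL : ℕ → LevelCode → ℕ
qdegL s (top r)         = r * suc (2 * s)
qdegL s (climb r e m a) =
  r * suc (2 * s) + (bit e * suc (2 * s) + suc m * (2 * suc s)) + qdegL (suc s) a

LevelCodeᶜ : ℕ → Class
LevelCodeᶜ s = record { Obj = LevelCode ; tdeg = tdegL ; qdeg = qdegL s }

Levels≅LevelCode : ∀ s → Σᶜ (λ n → Levelsᶜ s n OddRunᶜ LevelStepᶜ) ≅ LevelCodeᶜ s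
Levels≅LevelCode s = record
  { to = λ (n , x) → code s n x ; from = λ a → height a , tuple s a
  ; from∘to = λ (n , x) → tuple-code s n x ; to∘from = code-tuple s
  ; tdeg-to = λ (n , x) → tdeg-code s n x ; qdeg-to = λ (n , x) → qdeg-code s n x }
  where
  Levels : ℕ → ℕ → Class
  Levels s n = Levelsᶜ s n OddRunᶜ LevelStepᶜ

  code : ∀ s n → Obj (Levels s n) → LevelCode
  code s zero    r                 = top r
  code s (suc n) ((r , e , m) , x) = climb r e m (code (suc s) n x)

  height : LevelCode → ℕ
  height (top _)         = 0
  height (climb _ _ _ a) = suc (height a)

  tuple : ∀ s a → Obj (Levels s (height a))
  tuple s (top r)         = r
  tuple s (climb r e m a) = (r , e , m) , tuple (suc s) a

  tuple-code : ∀ s n x →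
    _≡_ {A = Σ ℕ λ n → Obj (Levels s n)} (height (code s n x) , tuple s (code s n x)) (n , x)
  tuple-code s zero    _                 = refl
  tuple-code s (suc n) ((r , e , m) , x) =
    cong (λ (k , y) → suc k , (r , e , m) , y) (tuple-code (suc s) n x)

  code-tuple : ∀ s a → code s (height a) (tuple s a) ≡ a
  code-tuple s (top _)         = refl
  code-tuple s (climb r e m a) = cong (climb r e m) (code-tuple (suc s) a)

  tdeg-code : ∀ s n x → tdegL (code s n x) ≡ tdeg (Levels s n) x
  tdeg-code s zero    _                 = refl
  tdeg-code s (suc n) ((r , e , _) , x) = cong (_+_ (r + bit e)) (tdeg-code (suc s) n x)

  qdeg-code : ∀ s n x → qdegL s (code s n x) ≡ qdeg (Levels s n) x
  qdeg-code s zero    _                 = refl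
  qdeg-code s (suc n) ((r , e , m) , x) =
    cong (_+_ (r * suc (2 * s) + (bit e * suc (2 * s) + suc m * (2 * suc s)))) (qdeg-code (suc s) n x)

-- Walks through the difference conditions

data Parity : Set where
  even odd : Parity

data Walk : Parity → Set where
  stop   : ∀ {p} → Walk p
  flip   : Walk even → Walk even
  toOdd  : Walk odd → Walk even
  up     : Walk even → Walk even
  repeat : Walk odd → Walk odd
  toEven : Bool → Walk even → Walk odd

pattern col-a = Fin.zero
pattern col-b = Fin.suc Fin.zero
pattern col-c = Fin.suc (Fin.suc Fin.zero)

colour : Bool → Colour
colour false = col-a
colour true  = col-c

-- A walk in state (s, c) stands at the part 2s of colour (colour c), or at the part 2s+1
-- of colour b; in the odd case c is carried along unused.
parts : ∀ {p} → ℕ → Bool → Walk p → ColSeq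
parts s c stop         = []
parts s c (flip w)     = (2 * s , colour (not c)) ∷ parts s (not c) w
parts s c (toOdd w)    = (suc (2 * s) , col-b) ∷ parts s c w
parts s c (up w)       = (2 * suc s , colour c) ∷ parts (suc s) c w
parts s c (repeat w)   = (suc (2 * s) , col-b) ∷ parts s c w
parts s c (toEven d w) = (2 * suc s , colour d) ∷ parts (suc s) d w

position : Parity → ℕ → ℕ
position even s = 2 * s
position odd  s = suc (2 * s)

currentColour : Parity → Bool → Colour
currentColour even c = colour c
currentColour odd  _ = col-b

even+1 : ∀ s → 2 * s + 1 ≡ suc (2 * s)
even+1 s = ℕ.+-comm (2 * s) 1

even+2 : ∀ s → 2 * s + 2 ≡ 2 * suc s
even+2 = solve-∀

odd+1 : ∀ s → suc (2 * s) + 1 ≡ 2 * suc s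
odd+1 = solve-∀

parts-grounded : ∀ {p} s c (w : Walk p) → GroundedFrom (position p s) (currentColour p c) (parts s c w)
parts-grounded s c     stop             = tt
parts-grounded s false (flip w)         = sym (ℕ.+-identityʳ (2 * s)) , parts-grounded s true w
parts-grounded s true  (flip w)         = sym (ℕ.+-identityʳ (2 * s)) , parts-grounded s false w
parts-grounded s false (toOdd w)        = sym (even+1 s) , parts-grounded s false w
parts-grounded s true  (toOdd w)        = sym (even+1 s) , parts-grounded s true w
parts-grounded s false (up w)           = sym (even+2 s) , parts-grounded (suc s) false w
parts-grounded s true  (up w)           = sym (even+2 s) , parts-grounded (suc s) true w
parts-grounded s c     (repeat w)       = sym (ℕ.+-identityʳ (suc (2 * s))) , parts-grounded s c w
parts-grounded s c     (toEven false w) = sym (odd+1 s) , parts-grounded (suc s) false w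
parts-grounded s c     (toEven true w)  = sym (odd+1 s) , parts-grounded (suc s) true w

parts-positive-even : ∀ s c (w : Walk even) → All Positive (parts (suc s) c w)
parts-positive-odd  : ∀ s c (w : Walk odd) → All Positive (parts s c w)
parts-positive-even s c stop         = []
parts-positive-even s c (flip w)     = s≤s z≤n ∷ parts-positive-even s (not c) w
parts-positive-even s c (toOdd w)    = s≤s z≤n ∷ parts-positive-odd (suc s) c w
parts-positive-even s c (up w)       = s≤s z≤n ∷ parts-positive-even (suc s) c w
parts-positive-odd  s c stop         = []
parts-positive-odd  s c (repeat w)   = s≤s z≤n ∷ parts-positive-odd s c w
parts-positive-odd  s c (toEven d w) = s≤s z≤n ∷ parts-positive-even s d w

next-position : ∀ {u v k w x : ℕ} → u ≡ v → x ≡ v + k → u + k ≡ w → w ≡ x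
next-position refl x≡v+k u+k≡w = trans (sym u+k≡w) (sym x≡v+k)

stay : ∀ {u v x} → u ≡ v → x ≡ v + 0 → u ≡ x
stay eq x≡ = next-position eq x≡ (ℕ.+-identityʳ _)

even→odd : ∀ s {v x} → 2 * s ≡ v → x ≡ v + 1 → suc (2 * s) ≡ x
even→odd s eq x≡ = next-position eq x≡ (even+1 s)

even→even : ∀ s {v x} → 2 * s ≡ v → x ≡ v + 2 → 2 * suc s ≡ x
even→even s eq x≡ = next-position eq x≡ (even+2 s)

odd→even : ∀ s {v x} → suc (2 * s) ≡ v → x ≡ v + 1 → 2 * suc s ≡ x
odd→even s eq x≡ = next-position eq x≡ (odd+1 s)

parse : ∀ p s c {v} → position p s ≡ v → (l : ColSeq) → GroundedFrom v (currentColour p c) l → Walk p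
parse p    s c     eq []                  _        = stop
parse even s false eq ((x , col-a) ∷ l) (x≡ , g) = up (parse even (suc s) false (even→even s eq x≡) l g)
parse even s false eq ((x , col-b) ∷ l) (x≡ , g) = toOdd (parse odd s false (even→odd s eq x≡) l g)
parse even s false eq ((x , col-c) ∷ l) (x≡ , g) = flip (parse even s true (stay eq x≡) l g)
parse even s true  eq ((x , col-a) ∷ l) (x≡ , g) = flip (parse even s false (stay eq x≡) l g)
parse even s true  eq ((x , col-b) ∷ l) (x≡ , g) = toOdd (parse odd s true (even→odd s eq x≡) l g)
parse even s true  eq ((x , col-c) ∷ l) (x≡ , g) = up (parse even (suc s) true (even→even s eq x≡) l g)
parse odd  s c     eq ((x , col-a) ∷ l) (x≡ , g) = toEven false (parse even (suc s) false (odd→even s eq x≡) l g)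
parse odd  s c     eq ((x , col-b) ∷ l) (x≡ , g) = repeat (parse odd s c (stay eq x≡) l g)
parse odd  s c     eq ((x , col-c) ∷ l) (x≡ , g) = toEven true (parse even (suc s) true (odd→even s eq x≡) l g)

parse-parts : ∀ {p} s c (w : Walk p) {v} (eq : position p s ≡ v) g → parse p s c eq (parts s c w) g ≡ w
parse-parts s c     stop             eq _        = refl
parse-parts s false (flip w)         eq (x≡ , g) = cong flip (parse-parts s true w (stay eq x≡) g)
parse-parts s true  (flip w)         eq (x≡ , g) = cong flip (parse-parts s false w (stay eq x≡) g)
parse-parts s false (toOdd w)        eq (x≡ , g) = cong toOdd (parse-parts s false w (even→odd s eq x≡) g)
parse-parts s true  (toOdd w)        eq (x≡ , g) = cong toOdd (parse-parts s true w (even→odd s eq x≡) g)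
parse-parts s false (up w)           eq (x≡ , g) = cong up (parse-parts (suc s) false w (even→even s eq x≡) g)
parse-parts s true  (up w)           eq (x≡ , g) = cong up (parse-parts (suc s) true w (even→even s eq x≡) g)
parse-parts s c     (repeat w)       eq (x≡ , g) = cong repeat (parse-parts s c w (stay eq x≡) g)
parse-parts s c     (toEven false w) eq (x≡ , g) =
  cong (toEven false) (parse-parts (suc s) false w (odd→even s eq x≡) g)
parse-parts s c     (toEven true w)  eq (x≡ , g) =
  cong (toEven true) (parse-parts (suc s) true w (odd→even s eq x≡) g)

∷-cong : ∀ {x y : ℕ} {d : Colour} {l l′ : ColSeq} → x ≡ y → l ≡ l′ →
         _≡_ {A = ColSeq} ((x , d) ∷ l) ((y , d) ∷ l′)
∷-cong refl refl = refl

parts-parse : ∀ p s c {v} (eq : position p s ≡ v) l g → parts s c (parse p s c eq l g) ≡ l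
parts-parse p    s c     eq []                  _        = refl
parts-parse even s false eq ((x , col-a) ∷ l) (x≡ , g) =
  ∷-cong (even→even s eq x≡) (parts-parse even (suc s) false (even→even s eq x≡) l g)
parts-parse even s false eq ((x , col-b) ∷ l) (x≡ , g) =
  ∷-cong (even→odd s eq x≡) (parts-parse odd s false (even→odd s eq x≡) l g)
parts-parse even s false eq ((x , col-c) ∷ l) (x≡ , g) =
  ∷-cong (stay eq x≡) (parts-parse even s true (stay eq x≡) l g)
parts-parse even s true  eq ((x , col-a) ∷ l) (x≡ , g) =
  ∷-cong (stay eq x≡) (parts-parse even s false (stay eq x≡) l g)
parts-parse even s true  eq ((x , col-b) ∷ l) (x≡ , g) =
  ∷-cong (even→odd s eq x≡) (parts-parse odd s true (even→odd s eq x≡) l g)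
parts-parse even s true  eq ((x , col-c) ∷ l) (x≡ , g) =
  ∷-cong (even→even s eq x≡) (parts-parse even (suc s) true (even→even s eq x≡) l g)
parts-parse odd  s c     eq ((x , col-a) ∷ l) (x≡ , g) =
  ∷-cong (odd→even s eq x≡) (parts-parse even (suc s) false (odd→even s eq x≡) l g)
parts-parse odd  s c     eq ((x , col-b) ∷ l) (x≡ , g) =
  ∷-cong (stay eq x≡) (parts-parse odd s c (stay eq x≡) l g)
parts-parse odd  s c     eq ((x , col-c) ∷ l) (x≡ , g) =
  ∷-cong (odd→even s eq x≡) (parts-parse even (suc s) true (odd→even s eq x≡) l g)

weightW : ∀ {p} → ℕ → Walk p → ℕ
weightW s stop         = 0
weightW s (flip w)     = 2 * s + weightW s w
weightW s (toOdd w)    = suc (2 * s) + weightW s w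
weightW s (up w)       = 2 * suc s + weightW (suc s) w
weightW s (repeat w)   = suc (2 * s) + weightW s w
weightW s (toEven _ w) = 2 * suc s + weightW (suc s) w

oddsW : ∀ {p} → Walk p → ℕ
oddsW stop         = 0
oddsW (flip w)     = oddsW w
oddsW (toOdd w)    = suc (oddsW w)
oddsW (up w)       = oddsW w
oddsW (repeat w)   = suc (oddsW w)
oddsW (toEven _ w) = oddsW w

weight-parts : ∀ {p} s c (w : Walk p) → weight (parts s c w) ≡ weightW s w
weight-parts s c stop         = refl
weight-parts s c (flip w)     = cong (_+_ (2 * s)) (weight-parts s (not c) w)
weight-parts s c (toOdd w)    = cong (_+_ (suc (2 * s))) (weight-parts s c w)
weight-parts s c (up w)       = cong (_+_ (2 * suc s)) (weight-parts (suc s) c w)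
weight-parts s c (repeat w)   = cong (_+_ (suc (2 * s))) (weight-parts s c w)
weight-parts s c (toEven d w) = cong (_+_ (2 * suc s)) (weight-parts (suc s) d w)

even%2 : ∀ s → 2 * s % 2 ≡ 0
even%2 s = trans (cong (_% 2) (ℕ.*-comm 2 s)) (m*n%n≡0 s 2)

odd%2 : ∀ s → suc (2 * s) % 2 ≡ 1
odd%2 s = trans (cong (λ n → suc n % 2) (ℕ.*-comm 2 s)) ([m+kn]%n≡m%n 1 s 2)

oddCount-parts : ∀ {p} s c (w : Walk p) → oddCount (parts s c w) ≡ oddsW w
oddCount-parts s c stop         = refl
oddCount-parts s c (flip w)     = cong₂ _+_ (even%2 s) (oddCount-parts s (not c) w)
oddCount-parts s c (toOdd w)    = cong₂ _+_ (odd%2 s) (oddCount-parts s c w)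
oddCount-parts s c (up w)       = cong₂ _+_ (even%2 (suc s)) (oddCount-parts (suc s) c w)
oddCount-parts s c (repeat w)   = cong₂ _+_ (odd%2 s) (oddCount-parts s c w)
oddCount-parts s c (toEven d w) = cong₂ _+_ (even%2 (suc s)) (oddCount-parts (suc s) d w)

-- Level codes are the walks from λ₀ = 0 that do not repeat it

Fresh : Walk even → Set
Fresh (flip _) = ⊥
Fresh _        = ⊤

Fresh-irrelevant : ∀ w (f f′ : Fresh w) → f ≡ f′
Fresh-irrelevant stop      _ _ = refl
Fresh-irrelevant (toOdd _) _ _ = refl
Fresh-irrelevant (up _)    _ _ = refl

fresh-≡ : ∀ {w w′} {f : Fresh w} {f′ : Fresh w′} → w ≡ w′ →
          _≡_ {A = Σ (Walk even) Fresh} (w , f) (w′ , f′)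
fresh-≡ {w} {f = f} {f′} refl = cong (w ,_) (Fresh-irrelevant w f f′)

leadingFlips : Walk even → ℕ
leadingFlips (flip w) = suc (leadingFlips w)
leadingFlips _        = 0

flips : ℕ → Walk even → Walk even
flips zero    w = w
flips (suc m) w = flip (flips m w)

repeats : ℕ → Walk odd → Walk odd
repeats zero    w = w
repeats (suc r) w = repeat (repeats r w)

-- Level s of climb r e m a has r + bit e odd parts 2s+1; if there are any, the flag e
-- selects the colour of the next even part (a when set, c otherwise).
toWalk : LevelCode → Walk even
toWalk (top zero)                = stop
toWalk (top (suc r))             = toOdd (repeats r stop)
toWalk (climb r true m a)        = toOdd (repeats r (toEven false (flips m (toWalk a))))
toWalk (climb zero false m a)    = up (flips m (toWalk a))
toWalk (climb (suc r) false m a) = toOdd (repeats r (toEven true (flips m (toWalk a))))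

addOdd : LevelCode → LevelCode
addOdd (top r)         = top (suc r)
addOdd (climb r e m a) = climb (suc r) e m a

-- The level code of an odd walk counts the odd part the walk stands at.
toLevels : ∀ {p} → Walk p → LevelCode
toLevels {even} stop      = top 0
toLevels {odd}  stop      = top 1
toLevels (flip w)         = toLevels w
toLevels (toOdd w)        = toLevels w
toLevels (up w)           = climb 0 false (leadingFlips w) (toLevels w)
toLevels (repeat w)       = addOdd (toLevels w)
toLevels (toEven true w)  = climb 1 false (leadingFlips w) (toLevels w)
toLevels (toEven false w) = climb 0 true (leadingFlips w) (toLevels w)

toWalk-fresh : ∀ a → Fresh (toWalk a)
toWalk-fresh (top zero)                = tt
toWalk-fresh (top (suc _))             = tt
toWalk-fresh (climb _ true _ _)        = tt
toWalk-fresh (climb zero false _ _)    = tt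
toWalk-fresh (climb (suc _) false _ _) = tt

leadingFlips-flips : ∀ m w → Fresh w → leadingFlips (flips m w) ≡ m
leadingFlips-flips (suc m) w f = cong suc (leadingFlips-flips m w f)
leadingFlips-flips zero stop      _ = refl
leadingFlips-flips zero (toOdd _) _ = refl
leadingFlips-flips zero (up _)    _ = refl

toLevels-flips : ∀ m w → toLevels (flips m w) ≡ toLevels w
toLevels-flips zero    w = refl
toLevels-flips (suc m) w = toLevels-flips m w

toLevels-repeats-stop : ∀ r → toLevels (repeats r stop) ≡ top (suc r)
toLevels-repeats-stop zero    = refl
toLevels-repeats-stop (suc r) = cong addOdd (toLevels-repeats-stop r)

toLevels-repeats : ∀ r w {k e m a} → toLevels w ≡ climb k e m a →
                   toLevels (repeats r w) ≡ climb (r + k) e m a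
toLevels-repeats zero    w eq = eq
toLevels-repeats (suc r) w eq = cong addOdd (toLevels-repeats r w eq)

toLevels-toWalk   : ∀ a → toLevels (toWalk a) ≡ a
climb-after-flips : ∀ k e m a →
  climb k e (leadingFlips (flips m (toWalk a))) (toLevels (flips m (toWalk a))) ≡ climb k e m a

toLevels-toWalk (top zero)                = refl
toLevels-toWalk (top (suc r))             = toLevels-repeats-stop r
toLevels-toWalk (climb zero false m a)    = climb-after-flips 0 false m a
toLevels-toWalk (climb (suc r) false m a) = trans (toLevels-repeats r _ (climb-after-flips 1 false m a))
                                                  (cong (λ k → climb k false m a) (ℕ.+-comm r 1))
toLevels-toWalk (climb r true m a)        = trans (toLevels-repeats r _ (climb-after-flips 0 true m a))
                                                  (cong (λ k → climb k true m a) (ℕ.+-identityʳ r))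

climb-after-flips k e m a = cong₂ (climb k e) (leadingFlips-flips m (toWalk a) (toWalk-fresh a))
                                              (trans (toLevels-flips m (toWalk a)) (toLevels-toWalk a))

toWalk-addOdd : ∀ a {w} → toWalk a ≡ toOdd w → toWalk (addOdd a) ≡ toOdd (repeat w)
toWalk-addOdd (top zero)                ()
toWalk-addOdd (top (suc _))             refl = refl
toWalk-addOdd (climb _ true _ _)        refl = refl
toWalk-addOdd (climb zero false _ _)    ()
toWalk-addOdd (climb (suc _) false _ _) refl = refl

toWalk-toLevels-even : ∀ w → flips (leadingFlips w) (toWalk (toLevels w)) ≡ w
toWalk-toLevels-odd  : ∀ w → toWalk (toLevels w) ≡ toOdd w
toWalk-toLevels-even stop             = refl
toWalk-toLevels-even (flip w)         = cong flip (toWalk-toLevels-even w)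
toWalk-toLevels-even (toOdd w)        = toWalk-toLevels-odd w
toWalk-toLevels-even (up w)           = cong up (toWalk-toLevels-even w)
toWalk-toLevels-odd  stop             = refl
toWalk-toLevels-odd  (repeat w)       = toWalk-addOdd (toLevels w) (toWalk-toLevels-odd w)
toWalk-toLevels-odd  (toEven true w)  = cong (λ v → toOdd (toEven true v)) (toWalk-toLevels-even w)
toWalk-toLevels-odd  (toEven false w) = cong (λ v → toOdd (toEven false v)) (toWalk-toLevels-even w)

toWalk-toLevels : ∀ w → Fresh w → toWalk (toLevels w) ≡ w
toWalk-toLevels w f =
  subst (λ k → flips k (toWalk (toLevels w)) ≡ w) (leadingFlips-flips 0 w f) (toWalk-toLevels-even w)

weightW-flips : ∀ s m w → weightW s (flips m w) ≡ m * (2 * s) + weightW s w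
weightW-flips s zero    w = refl
weightW-flips s (suc m) w =
  trans (cong (_+_ (2 * s)) (weightW-flips s m w)) (sym (ℕ.+-assoc (2 * s) (m * (2 * s)) _))

weightW-repeats : ∀ s r w → weightW s (repeats r w) ≡ r * suc (2 * s) + weightW s w
weightW-repeats s zero    w = refl
weightW-repeats s (suc r) w =
  trans (cong (_+_ (suc (2 * s))) (weightW-repeats s r w)) (sym (ℕ.+-assoc (suc (2 * s)) (r * suc (2 * s)) _))

weightW-up : ∀ s m w → weightW s (up (flips m w)) ≡ suc m * (2 * suc s) + weightW (suc s) w
weightW-up s m w =
  trans (cong (_+_ (2 * suc s)) (weightW-flips (suc s) m w)) (sym (ℕ.+-assoc (2 * suc s) _ _))

weightW-rise : ∀ s r d m w →
  weightW s (toOdd (repeats r (toEven d (flips m w))))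
    ≡ suc r * suc (2 * s) + suc m * (2 * suc s) + weightW (suc s) w
weightW-rise s r d m w = begin
  suc (2 * s) + weightW s (repeats r (toEven d (flips m w)))
    ≡⟨ cong (_+_ (suc (2 * s))) (weightW-repeats s r _) ⟩
  suc (2 * s) + (r * suc (2 * s) + weightW s (toEven d (flips m w)))
    ≡⟨ cong (λ n → suc (2 * s) + (r * suc (2 * s) + n)) (weightW-up s m w) ⟩
  suc (2 * s) + (r * suc (2 * s) + (suc m * (2 * suc s) + weightW (suc s) w))
    ≡⟨ reassoc (suc (2 * s)) _ _ _ ⟩
  suc r * suc (2 * s) + suc m * (2 * suc s) + weightW (suc s) w
    ∎
  where
  open ≡-Reasoning
  reassoc : ∀ a b c d → a + (b + (c + d)) ≡ a + b + c + d
  reassoc = solve-∀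

oddsW-flips : ∀ m w → oddsW (flips m w) ≡ oddsW w
oddsW-flips zero    w = refl
oddsW-flips (suc m) w = oddsW-flips m w

oddsW-repeats : ∀ r w → oddsW (repeats r w) ≡ r + oddsW w
oddsW-repeats zero    w = refl
oddsW-repeats (suc r) w = cong suc (oddsW-repeats r w)

oddsW-rise : ∀ r d m w → oddsW (toOdd (repeats r (toEven d (flips m w)))) ≡ suc r + oddsW w
oddsW-rise r d m w = cong suc (trans (oddsW-repeats r _) (cong (_+_ r) (oddsW-flips m w)))

tdeg-toWalk : ∀ a → oddsW (toWalk a) ≡ tdegL a
tdeg-toWalk (top zero)                = refl
tdeg-toWalk (top (suc r))             = cong suc (trans (oddsW-repeats r stop) (ℕ.+-identityʳ r))
tdeg-toWalk (climb zero false m a)    = trans (oddsW-flips m (toWalk a)) (tdeg-toWalk a)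
tdeg-toWalk (climb (suc r) false m a) =
  trans (oddsW-rise r true m (toWalk a)) (cong₂ _+_ (sym (ℕ.+-identityʳ (suc r))) (tdeg-toWalk a))
tdeg-toWalk (climb r true m a)        =
  trans (oddsW-rise r false m (toWalk a)) (cong₂ _+_ (ℕ.+-comm 1 r) (tdeg-toWalk a))

qdeg-toWalk : ∀ s a → weightW s (toWalk a) ≡ qdegL s a
qdeg-toWalk s (top zero)                = refl
qdeg-toWalk s (top (suc r))             =
  cong (_+_ (suc (2 * s))) (trans (weightW-repeats s r stop) (ℕ.+-identityʳ _))
qdeg-toWalk s (climb zero false m a)    =
  trans (weightW-up s m (toWalk a)) (cong (_+_ (suc m * (2 * suc s))) (qdeg-toWalk (suc s) a))
qdeg-toWalk s (climb (suc r) false m a) =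
  trans (weightW-rise s r true m (toWalk a))
        (cong (_+_ (suc r * suc (2 * s) + suc m * (2 * suc s))) (qdeg-toWalk (suc s) a))
qdeg-toWalk s (climb r true m a)        =
  trans (weightW-rise s r false m (toWalk a))
        (trans (cong (_+_ (suc r * suc (2 * s) + suc m * (2 * suc s))) (qdeg-toWalk (suc s) a))
               (flagged r (suc (2 * s)) (suc m * (2 * suc s)) (qdegL (suc s) a)))
  where
  flagged : ∀ r S Y Q → suc r * S + Y + Q ≡ r * S + (1 * S + Y) + Q
  flagged = solve-∀

FreshWalkᶜ : Class
FreshWalkᶜ = record
  { Obj = Σ (Walk even) Fresh ; tdeg = λ (w , _) → oddsW w ; qdeg = λ (w , _) → weightW 0 w }

LevelCode≅FreshWalk : LevelCodeᶜ 0 ≅ FreshWalkᶜ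
LevelCode≅FreshWalk = record
  { to = λ a → toWalk a , toWalk-fresh a
  ; from = λ (w , _) → toLevels w
  ; from∘to = toLevels-toWalk
  ; to∘from = λ (w , f) → fresh-≡ (toWalk-toLevels w f)
  ; tdeg-to = tdeg-toWalk
  ; qdeg-to = qdeg-toWalk 0 }

Groundedᶜ : Class
Groundedᶜ = record
  { Obj = Σ ColSeq Grounded ; tdeg = λ (l , _) → oddCount l ; qdeg = λ (l , _) → weight l }

GroundedFrom-irrelevant : ∀ v c l (g g′ : GroundedFrom v c l) → g ≡ g′
GroundedFrom-irrelevant v c []            _       _         = refl
GroundedFrom-irrelevant v c ((x , d) ∷ l) (p , g) (p′ , g′) =
  cong₂ _,_ (ℕ.≡-irrelevant p p′) (GroundedFrom-irrelevant x d l g g′)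

grounded-≡ : ∀ {l l′} {g : Grounded l} {g′ : Grounded l′} → l ≡ l′ →
             _≡_ {A = Σ ColSeq Grounded} (l , g) (l′ , g′)
grounded-≡ {l} {g = pos , g} {pos′ , g′} refl =
  cong₂ (λ p q → l , p , q) (All.irrelevant ℕ.≤-irrelevant pos pos′)
                            (GroundedFrom-irrelevant 0 col-a l g g′)

fresh-positive : ∀ w → Fresh w → All Positive (parts 0 false w)
fresh-positive stop      _ = []
fresh-positive (toOdd w) _ = s≤s z≤n ∷ parts-positive-odd 0 false w
fresh-positive (up w)    _ = s≤s z≤n ∷ parts-positive-even 0 false w

parse-fresh : ∀ l → All Positive l → (g : GroundedFrom 0 col-a l) → Fresh (parse even 0 false refl l g)
parse-fresh []                  _         _        = tt
parse-fresh ((_ , col-a) ∷ _)   _         _        = tt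
parse-fresh ((_ , col-b) ∷ _)   _         _        = tt
parse-fresh ((.0 , col-c) ∷ _)  (() ∷ _)  (refl , _)

FreshWalk≅Grounded : FreshWalkᶜ ≅ Groundedᶜ
FreshWalk≅Grounded = record
  { to = λ (w , f) → parts 0 false w , fresh-positive w f , parts-grounded 0 false w
  ; from = λ (l , pos , g) → parse even 0 false refl l g , parse-fresh l pos g
  ; from∘to = λ (w , _) → fresh-≡ (parse-parts 0 false w refl (parts-grounded 0 false w))
  ; to∘from = λ (l , _ , g) → grounded-≡ (parts-parse even 0 false refl l g)
  ; tdeg-to = λ (w , _) → oddCount-parts 0 false w
  ; qdeg-to = λ (w , _) → weight-parts 0 false w }

rhs-IsGF-Grounded : rhs IsGFOf Groundedᶜ
rhs-IsGF-Grounded = IsGFOf-≅ rhs-IsGF (begin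
  Σᶜ Termᶜ                                     ≅⟨ Σᶜ-cong Term≅Levels ⟩
  Σᶜ (λ n → Levelsᶜ 0 n OddRunᶜ LevelStepᶜ)    ≅⟨ Levels≅LevelCode 0 ⟩
  LevelCodeᶜ 0                                 ≅⟨ LevelCode≅FreshWalk ⟩
  FreshWalkᶜ                                   ≅⟨ FreshWalk≅Grounded ⟩
  Groundedᶜ                                    ∎)
  where open ≅-Reasoning

Fibre-Grounded↔GP : ∀ N k → Fibre Groundedᶜ k N ↔ GP N k
Fibre-Grounded↔GP N k = mk↔ₛ′ (λ ((l , g) , p , q) → l , g , q , p) (λ (l , g , q , p) → (l , g) , p , q)
  (λ _ → refl) (λ _ → refl)

lemma2p10 : (N k : ℕ) → Σ ℕ (λ m → (rhs k N ≡ + m) × (Fin m ↔ GP N k))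
lemma2p10 N k = IsCardOf-↔ (rhs-IsGF-Grounded k N) (Fibre-Grounded↔GP N k)
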